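{- Let $p\ge 3$ be a prime and, for each nonzero integer $m$, define integers $d_m(n)$ by $$\frac{1}{(1-x)^{m}}\prod_{i=0}^{\infty}\frac{1}{(1-x^{p^{i}})^{(p-1)m}}=\sum_{n=0}^{\infty}d_{m}(n)x^{n}.$$ Then the sequence $\left(\frac{d_m(n)}{pm}\bmod p\right)_{n\ge 1}$ depends only on the sign of $m$: if $m_1,m_2$ are nonzero integers of the same sign then $\frac{d_{m_1}(n)}{pm_1}\equiv\frac{d_{m_2}(n)}{pm_2}\pmod p$ for all $n\ge1$.
   Context: For $n\ge 1$ one has $\nu_p(d_m(n))=\nu_p(m)+1$, so $d_m(n)/(pm)$ is a rational number whose denominator is prime to $p$; "$\bmod p$" means its image in $\mathbb{Z}/p\mathbb{Z}$. -}

module Defs where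

open import Data.Nat as ℕ using (ℕ; zero; suc; _^_; _∸_; _≡ᵇ_)
open import Data.Nat.Divisibility using (_∣_; _∣?_)
open import Data.Integer as ℤ using (ℤ; +_; -[1+_])
open import Data.Rational as ℚ using (ℚ; ↧ₙ_)
open import Data.Bool using (if_then_else_)
open import Data.List using (List; foldr; map; upTo)
open import Data.Product using (∃; _×_)
open import Relation.Nullary using (¬_; does)
open import Relation.Binary.PropositionalEquality using (_≡_)

Series : Set
Series = ℕ → ℤ

sumℤ : List ℤ → ℤ
sumℤ = foldr ℤ._+_ (+ 0)

_⋆_ : Series → Series → Series
(f ⋆ g) n = sumℤ (map (λ i → f i ℤ.* g (n ∸ i)) (upTo (suc n)))

infixl 7 _⋆_

oneS : Series
oneS zero    = + 1
oneS (suc _) = + 0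

powS : Series → ℕ → Series
powS f zero    = oneS
powS f (suc a) = f ⋆ powS f a

-- 1/(1 - x^k) = Σ_j x^{kj}   (used with k ≥ 1)
geomInv : ℕ → Series
geomInv k n = if does (k ∣? n) then + 1 else + 0

oneMinus : ℕ → Series
oneMinus k zero    = + 1
oneMinus k (suc n) = if (suc n ≡ᵇ k) then ℤ.- (+ 1) else + 0

-- (1 - x^k)^(-a) for an integer exponent a
invPow : ℕ → ℤ → Series
invPow k (+ a)     = powS (geomInv k) a
invPow k -[1+ a ]  = powS (oneMinus k) (suc a)

prodFactors : ℕ → ℤ → ℕ → Series
prodFactors p e zero    = oneS
prodFactors p e (suc N) = prodFactors p e N ⋆ invPow (p ^ N) e

-- Factors with p^i > n do not affect the coefficient of x^n, so the
-- infinite product is truncated at i < n + 1 (p^(n+1) > n for p ≥ 2).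
d : ℕ → ℤ → ℕ → ℤ
d p m n = (invPow 1 m ⋆ prodFactors p (+ (p ∸ 1) ℤ.* m) (suc n)) n

-- a / b as a rational (b ≠ 0; junk value 0 when b = 0)
divQ : ℤ → ℤ → ℚ
divQ a (+ zero)    = ℚ.0ℚ
divQ a (+ (suc k)) = a ℚ./ suc k
divQ a -[1+ k ]    = (ℤ.- a) ℚ./ suc k

-- Congruence modulo p in ℤ_(p) ⊂ ℚ: (r - s)/p has denominator prime to p.
_≡_[modℚ_] : ℚ → ℚ → ℕ → Set
r ≡ s [modℚ p ] = ∃ λ (t : ℚ) → (¬ (p ∣ ↧ₙ t)) × (r ℚ.- s ≡ (+ p ℚ./ 1) ℚ.* t)

SameSign : ℤ → ℤ → Set
SameSign m₁ m₂ = ((+ 0 ℤ.< m₁) × (+ 0 ℤ.< m₂)) ⊎' ((m₁ ℤ.< + 0) × (m₂ ℤ.< + 0))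
  where open import Data.Sum renaming (_⊎_ to _⊎'_)

-- Write T = 1/((1 - x) ∏_i (1 - x^(p^i))^(p-1)), so that Σ_n d_m(n) x^n = T^m, and G = 1/T.
-- By Frobenius, (1 - x^K)^p ≡ 1 - x^(pK) (mod p), so the product G telescopes modulo p to
-- 1 - x^(p^N) once truncated at i < N, and T ≡ 1/(1 - x^(p^N)) (mod p).  Below degree p^N both
-- series therefore have the shape 1 + pU with U integral, and d_m(n) is the n-th coefficient of
-- (1 + pU)^|m|, with U taken from T if m > 0 and from G if m < 0.  Writing |m| = c p^v with p ∤ c,
-- for odd p (so that p ∣ C(p,2)) one gets (1 + pU)^|m| ≡ 1 + |m| p U (mod p^(v+2)); hence
-- d_m(n)/(pm) ≡ ±U_n (mod p), which depends on m only through its sign.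
module Submission where

open import Defs
open import Algebra.Bundles using (CommutativeRing; Semiring)
open import Data.Bool using (true; false; if_then_else_)
open import Data.Empty using (⊥-elim)
open import Data.Fin as Fin using (Fin; toℕ; fromℕ; inject₁)
import Data.Fin.Properties as FinP
open import Data.Integer using (ℤ; +_; -[1+_])
import Data.Integer as ℤ
import Data.Integer.Properties as ℤP
import Data.Integer.Tactic.RingSolver as ℤ-Solver
open import Data.List using (map; applyUpTo)
open import Data.Nat using (ℕ; zero; suc; _∸_; _<_; _≤_; s≤s; z≤n; z<s; _≡ᵇ_; NonZero)
import Data.Nat as ℕ
import Data.Nat.Properties as ℕP
open import Data.Nat.Combinatorics using (_C_; nC1≡n; nCn≡1; nCk+nC[k+1]≡[n+1]C[k+1]; k>n⇒nCk≡0)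
open import Data.Nat.Divisibility using (_∣_; _∣?_; divides; ∣-refl; ∣-trans; m∣m*n; ∣⇒≤; ∣m+n∣m⇒∣n; ∣m∣n⇒∣m+n)
import Data.Nat.GCD as ℕGCD
open import Data.Nat.Induction using (<-rec)
open import Data.Nat.Primality using (Prime; euclidsLemma; ¬prime[0])
import Data.Nat.Tactic.RingSolver as ℕ-Solver
open import Data.Product using (∃; ∃₂; _×_; _,_; proj₂; Σ)
open import Data.Rational as ℚ using (↧_; ↧ₙ_; toℚᵘ)
import Data.Rational.Properties as ℚP
open import Data.Rational.Unnormalised as ℚᵘ using (mkℚᵘ; *≡*)
import Data.Rational.Unnormalised.Properties as ℚᵘP
open import Data.Sum using (inj₁; inj₂)
open import Data.Vec.Functional using (init; tail; last)
open import Function using (_∘_)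
open import Level using (_⊔_)
open import Relation.Binary.Bundles using (Setoid)
open import Relation.Binary.PropositionalEquality as ≡ using (_≡_; _≗_; cong; cong₂)
open import Relation.Nullary using (¬_; yes; no)

-- Binomial coefficients and p-adic valuations

[1+k]*[1+n]C[1+k]≡[1+n]*nCk : ∀ n k → suc k ℕ.* (suc n C suc k) ≡ suc n ℕ.* (n C k)
[1+k]*[1+n]C[1+k]≡[1+n]*nCk zero    zero    = ≡.refl
[1+k]*[1+n]C[1+k]≡[1+n]*nCk zero    (suc k) = begin
  suc (suc k) ℕ.* (1 C suc (suc k)) ≡⟨ cong (suc (suc k) ℕ.*_) (k>n⇒nCk≡0 {1} {suc (suc k)} (s≤s (s≤s z≤n))) ⟩
  suc (suc k) ℕ.* 0                 ≡⟨ ℕP.*-zeroʳ (suc (suc k)) ⟩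
  0                                 ≡⟨ cong (1 ℕ.*_) (k>n⇒nCk≡0 {0} {suc k} (s≤s z≤n)) ⟨
  1 ℕ.* (0 C suc k)                 ∎
  where open ≡.≡-Reasoning
[1+k]*[1+n]C[1+k]≡[1+n]*nCk (suc n) zero    =
  ≡.trans (ℕP.+-identityʳ _) (≡.trans (nC1≡n (suc (suc n))) (≡.sym (ℕP.*-identityʳ (suc (suc n)))))
[1+k]*[1+n]C[1+k]≡[1+n]*nCk (suc n) (suc k) = begin
  suc (suc k) ℕ.* (suc N C suc (suc k))
    ≡⟨ cong (suc (suc k) ℕ.*_) (nCk+nC[k+1]≡[n+1]C[k+1] N (suc k)) ⟨
  suc (suc k) ℕ.* (N C suc k ℕ.+ N C suc (suc k))
    ≡⟨ distribute (suc k) (N C suc k) (N C suc (suc k)) ⟩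
  N C suc k ℕ.+ suc k ℕ.* (N C suc k) ℕ.+ suc (suc k) ℕ.* (N C suc (suc k))
    ≡⟨ cong₂ (λ a b → N C suc k ℕ.+ a ℕ.+ b) ([1+k]*[1+n]C[1+k]≡[1+n]*nCk n k) ([1+k]*[1+n]C[1+k]≡[1+n]*nCk n (suc k)) ⟩
  N C suc k ℕ.+ N ℕ.* (n C k) ℕ.+ N ℕ.* (n C suc k)
    ≡⟨ factor (N C suc k) N (n C k) (n C suc k) ⟩
  N C suc k ℕ.+ N ℕ.* (n C k ℕ.+ n C suc k)
    ≡⟨ cong (λ z → N C suc k ℕ.+ N ℕ.* z) (nCk+nC[k+1]≡[n+1]C[k+1] n k) ⟩
  N C suc k ℕ.+ N ℕ.* (N C suc k) ∎
  where
  open ≡.≡-Reasoning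
  N = suc n
  distribute : ∀ k a b → suc k ℕ.* (a ℕ.+ b) ≡ a ℕ.+ k ℕ.* a ℕ.+ suc k ℕ.* b
  distribute = ℕ-Solver.solve-∀
  factor : ∀ a N x y → a ℕ.+ N ℕ.* x ℕ.+ N ℕ.* y ≡ a ℕ.+ N ℕ.* (x ℕ.+ y)
  factor = ℕ-Solver.solve-∀

[1+k]C2≡k+kC2 : ∀ k → suc k C 2 ≡ k ℕ.+ k C 2
[1+k]C2≡k+kC2 k = ≡.trans (≡.sym (nCk+nC[k+1]≡[n+1]C[k+1] k 1)) (cong (ℕ._+ k C 2) (nC1≡n k))

prime∣pCk : ∀ {p k} → Prime p → 0 < k → k < p → p ∣ p C k
prime∣pCk {zero}          pr _ _   = ⊥-elim (¬prime[0] pr)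
prime∣pCk {suc n} {suc k} pr _ k<p
  with euclidsLemma (suc k) (suc n C suc k) pr
         (≡.subst (suc n ∣_) (≡.sym ([1+k]*[1+n]C[1+k]≡[1+n]*nCk n k)) (m∣m*n (n C k)))
... | inj₁ p∣1+k = ⊥-elim (ℕP.<⇒≱ k<p (∣⇒≤ p∣1+k))
... | inj₂ p∣pCk = p∣pCk

p-free-part : ∀ {p} → 1 < p → ∀ m → 0 < m → ∃₂ λ c v → m ≡ c ℕ.* p ℕ.^ v × ¬ p ∣ c
p-free-part {p} 1<p = <-rec (λ m → 0 < m → Decomposition m) split
  where
  Decomposition : ℕ → Set
  Decomposition m = ∃₂ λ c v → m ≡ c ℕ.* p ℕ.^ v × ¬ p ∣ c
  split : ∀ m → (∀ {q} → q < m → 0 < q → Decomposition q) → 0 < m → Decomposition m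
  split m rec 0<m with p ∣? m
  ... | no p∤m = m , 0 , ≡.sym (ℕP.*-identityʳ m) , p∤m
  ... | yes (divides zero    m≡0)    = ⊥-elim (ℕP.<⇒≢ 0<m (≡.sym m≡0))
  ... | yes (divides (suc q) m≡qp) with rec (≡.subst (suc q <_) (≡.sym m≡qp) (ℕP.m<m*n (suc q) p 1<p)) z<s
  ...   | c , v , q≡cp^v , p∤c = c , suc v , ≡.trans m≡qp (≡.trans (cong (ℕ._* p) q≡cp^v) (reassociate c (p ℕ.^ v) p)) , p∤c
    where
    reassociate : ∀ a b c → a ℕ.* b ℕ.* c ≡ a ℕ.* (c ℕ.* b)
    reassociate = ℕ-Solver.solve-∀

n≤p^n : ∀ {p} → 1 < p → ∀ n → n ≤ p ℕ.^ n
n≤p^n 1<p zero    = z≤n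
n≤p^n 1<p (suc n) = ℕP.≤-<-trans (n≤p^n 1<p n) (ℕP.^-monoʳ-< _ 1<p (ℕP.n<1+n n))

-- Congruences in a commutative ring

module Congruence {c ℓ} (R : CommutativeRing c ℓ) where

  open CommutativeRing R
  open import Algebra.Definitions.RawSemiring (Semiring.rawSemiring semiring) using (_^_) renaming (_×_ to _·_)
  open import Algebra.Properties.Semiring.Mult semiring using (×-homo-+; ×1-homo-*; ×-assoc-*; ×-congʳ)
  open import Algebra.Properties.Semiring.Sum semiring using (sum; *-distribˡ-sum)
  open import Algebra.Properties.Monoid.Sum +-monoid using (sum-init-last; sum-cong-≋)
  open import Algebra.Properties.CommutativeSemiring.Binomial commutativeSemiring using (theorem; binomialTerm)
  open import Algebra.Properties.Semiring.Exp semiring using (^-assocʳ; ^-congˡ)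
  open import Algebra.Properties.Ring ring using (-‿distribʳ-*)
  open import Algebra.Solver.Ring.NaturalCoefficients.Default commutativeSemiring
  import Relation.Binary.Reasoning.Setoid
  module ≈-Reasoning = Relation.Binary.Reasoning.Setoid setoid

  ι : ℕ → Carrier
  ι k = k · 1#

  ι-+ : ∀ m n → ι (m ℕ.+ n) ≈ ι m + ι n
  ι-+ m n = ×-homo-+ 1# m n

  ι-* : ∀ m n → ι (m ℕ.* n) ≈ ι m * ι n
  ι-* = ×1-homo-*

  ι-^ : ∀ m n → ι (m ℕ.^ n) ≈ ι m ^ n
  ι-^ m zero    = +-identityʳ 1#
  ι-^ m (suc n) = trans (ι-* m (m ℕ.^ n)) (*-congˡ (ι-^ m n))

  ·≈ι* : ∀ n x → n · x ≈ ι n * x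
  ·≈ι* n x = trans (×-congʳ n (sym (*-identityˡ x))) (sym (×-assoc-* n 1# x))

  1#-^ : ∀ n → 1# ^ n ≈ 1#
  1#-^ zero    = refl
  1#-^ (suc n) = trans (*-identityˡ _) (1#-^ n)

  ^-* : ∀ x m n → x ^ (m ℕ.* n) ≈ (x ^ n) ^ m
  ^-* x m n = trans (reflexive (cong (x ^_) (ℕP.*-comm m n))) (sym (^-assocʳ x n m))

  infix 4 _≈_[mod_]

  record _≈_[mod_] (x y a : Carrier) : Set (c ⊔ ℓ) where
    constructor mod-by
    field
      quotient   : Carrier
      ≈+multiple : x ≈ y + a * quotient

  ≈⇒≈[mod] : ∀ {x y} a → x ≈ y → x ≈ y [mod a ]
  ≈⇒≈[mod] {y = y} a x≈y = mod-by 0# (trans x≈y (solve 2 (λ y a → y := y :+ a :* con 0) refl y a))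

  ≈[mod]-sym : ∀ {x y a} → x ≈ y [mod a ] → y ≈ x [mod a ]
  ≈[mod]-sym {x} {y} {a} (mod-by k x≈y+ak) = mod-by (- k) (begin
    y                       ≈⟨ +-identityʳ y ⟨
    y + 0#                  ≈⟨ +-congˡ (zeroʳ a) ⟨
    y + a * 0#              ≈⟨ +-congˡ (*-congˡ (-‿inverseʳ k)) ⟨
    y + a * (k - k)         ≈⟨ +-congˡ (distribˡ a k (- k)) ⟩
    y + (a * k + a * - k)   ≈⟨ +-assoc y (a * k) (a * - k) ⟨
    y + a * k + a * - k     ≈⟨ +-congʳ x≈y+ak ⟨
    x + a * - k             ∎)
    where open ≈-Reasoning

  ≈[mod]-trans : ∀ {x y z a} → x ≈ y [mod a ] → y ≈ z [mod a ] → x ≈ z [mod a ]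
  ≈[mod]-trans {z = z} {a} (mod-by k x≈y+ak) (mod-by l y≈z+al) = mod-by (l + k)
    (trans x≈y+ak (trans (+-congʳ y≈z+al) (solve 4 (λ z a k l → z :+ a :* l :+ a :* k := z :+ a :* (l :+ k)) refl z a k l)))

  ≈[mod]-setoid : Carrier → Setoid c (c ⊔ ℓ)
  ≈[mod]-setoid a = record
    { Carrier       = Carrier
    ; _≈_           = _≈_[mod a ]
    ; isEquivalence = record { refl = ≈⇒≈[mod] a refl ; sym = ≈[mod]-sym ; trans = ≈[mod]-trans }
    }

  module ≈[mod]-Reasoning (a : Carrier) = Relation.Binary.Reasoning.Setoid (≈[mod]-setoid a)

  ≈[mod]-+ : ∀ {x y u v a} → x ≈ y [mod a ] → u ≈ v [mod a ] → x + u ≈ y + v [mod a ]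
  ≈[mod]-+ {y = y} {v = v} {a} (mod-by k x≈) (mod-by l u≈) = mod-by (k + l)
    (trans (+-cong x≈ u≈) (solve 5 (λ y v a k l → y :+ a :* k :+ (v :+ a :* l) := y :+ v :+ a :* (k :+ l)) refl y v a k l))

  ≈[mod]-* : ∀ {x y u v a} → x ≈ y [mod a ] → u ≈ v [mod a ] → x * u ≈ y * v [mod a ]
  ≈[mod]-* {y = y} {v = v} {a} (mod-by k x≈) (mod-by l u≈) = mod-by (k * v + y * l + a * k * l)
    (trans (*-cong x≈ u≈) (solve 5 (λ y v a k l → (y :+ a :* k) :* (v :+ a :* l)
                                                := y :* v :+ a :* (k :* v :+ y :* l :+ a :* k :* l)) refl y v a k l))

  ≈[mod]-^ : ∀ {x y a} → x ≈ y [mod a ] → ∀ n → x ^ n ≈ y ^ n [mod a ]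
  ≈[mod]-^ {a = a} x≡y zero    = ≈⇒≈[mod] a refl
  ≈[mod]-^ {a = a} x≡y (suc n) = ≈[mod]-* x≡y (≈[mod]-^ x≡y n)

  ≈[mod]-divisor : ∀ {x y a b m} → a * b ≈ m → x ≈ y [mod m ] → x ≈ y [mod a ]
  ≈[mod]-divisor {a = a} {b} ab≈m (mod-by k x≈) = mod-by (b * k)
    (trans x≈ (+-congˡ (trans (*-congʳ (sym ab≈m)) (*-assoc a b k))))

  ≈[mod]-split : ∀ {x y z a b} (x≡y : x ≈ y [mod a ]) → y ≈ z [mod b ] → x ≈ z + a * _≈_[mod_].quotient x≡y [mod b ]
  ≈[mod]-split {a = a} {b} (mod-by k x≈y+ak) y≡z = ≈[mod]-trans (≈⇒≈[mod] b x≈y+ak) (≈[mod]-+ y≡z (≈⇒≈[mod] b (refl {a * k})))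

  1-y≈1 : ∀ y → 1# - y ≈ 1# [mod y ]
  1-y≈1 y = mod-by (- 1#) (+-congˡ (trans (-‿cong (sym (*-identityʳ y))) (-‿distribʳ-* y 1#)))

  1+x-^-expansion : ∀ x k → (1# + x) ^ k ≈ 1# + ι k * x + ι (k C 2) * (x * x) [mod x * x * x ]
  1+x-^-expansion x zero    = ≈⇒≈[mod] _ (solve 1 (λ x → con 1 := con 1 :+ con 0 :* x :+ con 0 :* (x :* x)) refl x)
  1+x-^-expansion x (suc k) = mod-by (ι (k C 2) + r + x * r) (begin
    (1# + x) * (1# + x) ^ k
      ≈⟨ *-congˡ eq ⟩
    (1# + x) * (1# + ι k * x + ι (k C 2) * (x * x) + x * x * x * r)
      ≈⟨ solve 4 (λ x K C r → (con 1 :+ x) :* (con 1 :+ K :* x :+ C :* (x :* x) :+ x :* x :* x :* r)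
                          := con 1 :+ (con 1 :+ K) :* x :+ (K :+ C) :* (x :* x) :+ x :* x :* x :* (C :+ r :+ x :* r))
               refl x (ι k) (ι (k C 2)) r ⟩
    1# + (1# + ι k) * x + (ι k + ι (k C 2)) * (x * x) + x * x * x * (ι (k C 2) + r + x * r)
      ≈⟨ +-congʳ (+-congˡ (*-congʳ (trans (sym (ι-+ k (k C 2))) (reflexive (cong ι (≡.sym ([1+k]C2≡k+kC2 k))))))) ⟩
    1# + ι (suc k) * x + ι (suc k C 2) * (x * x) + x * x * x * (ι (k C 2) + r + x * r) ∎)
    where
    open ≈-Reasoning
    open _≈_[mod_] (1+x-^-expansion x k) renaming (quotient to r; ≈+multiple to eq)

  1+x-^ : ∀ x k → (1# + x) ^ k ≈ 1# + ι k * x [mod x * x ]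
  1+x-^ x k = mod-by (ι (k C 2) + x * r) (trans eq
    (solve 4 (λ x K C r → con 1 :+ K :* x :+ C :* (x :* x) :+ x :* x :* x :* r := con 1 :+ K :* x :+ x :* x :* (C :+ x :* r))
       refl x (ι k) (ι (k C 2)) r))
    where open _≈_[mod_] (1+x-^-expansion x k) renaming (quotient to r; ≈+multiple to eq)

  module _ {p} (p∣pC2 : p ∣ p C 2) where

    private
      P = ι p
      open _∣_ p∣pC2 renaming (quotient to h; equality to pC2≡hp)

    1+pw-^p : ∀ w → (1# + P * w) ^ p ≈ 1# + P * (P * w) [mod P * P * (P * w) ]
    1+pw-^p w = begin
      (1# + P * w) ^ p
        ≈⟨ ≈[mod]-divisor (solve 2 (λ P w → P :* P :* (P :* w) :* (w :* w) := P :* w :* (P :* w) :* (P :* w)) refl P w)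
                          (1+x-^-expansion (P * w) p) ⟩
      1# + P * (P * w) + ι (p C 2) * (P * w * (P * w))
        ≈⟨ ≈⇒≈[mod] _ (+-congˡ (trans (*-congʳ (trans (reflexive (cong ι pC2≡hp)) (ι-* h p)))
             (solve 3 (λ P w H → H :* P :* (P :* w :* (P :* w)) := P :* P :* (P :* w) :* (H :* w)) refl P w (ι h)))) ⟩
      1# + P * (P * w) + P * P * (P * w) * (ι h * w)
        ≈⟨ mod-by (ι h * w) refl ⟩
      1# + P * (P * w) ∎
      where open ≈[mod]-Reasoning (P * P * (P * w))

    1+py-^[p^v] : ∀ y v → (1# + P * y) ^ (p ℕ.^ v) ≈ 1# + P ^ suc v * y [mod P ^ suc (suc v) ]
    1+py-^[p^v] y zero    = ≈⇒≈[mod] _ (trans (*-identityʳ _) (+-congˡ (*-congʳ (sym (*-identityʳ P)))))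
    1+py-^[p^v] y (suc v) = begin
      (1# + P * y) ^ (p ℕ.* p ℕ.^ v)
        ≈⟨ ≈⇒≈[mod] _ (^-* (1# + P * y) p (p ℕ.^ v)) ⟩
      ((1# + P * y) ^ (p ℕ.^ v)) ^ p
        ≈⟨ ≈⇒≈[mod] _ (^-congˡ p (trans IH (solve 4 (λ P Q y k → con 1 :+ P :* Q :* y :+ P :* (P :* Q) :* k
                                                               := con 1 :+ P :* (Q :* (y :+ P :* k))) refl P (P ^ v) y k))) ⟩
      (1# + P * w) ^ p
        ≈⟨ ≈[mod]-divisor (solve 4 (λ P Q y k → P :* (P :* (P :* Q)) :* (y :+ P :* k) := P :* P :* (P :* (Q :* (y :+ P :* k))))
                                   refl P (P ^ v) y k)
                          (1+pw-^p w) ⟩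
      1# + P * (P * w)
        ≈⟨ ≈⇒≈[mod] _ (solve 4 (λ P Q y k → con 1 :+ P :* (P :* (Q :* (y :+ P :* k)))
                                          := con 1 :+ P :* (P :* Q) :* y :+ P :* (P :* (P :* Q)) :* k) refl P (P ^ v) y k) ⟩
      1# + P ^ suc (suc v) * y + P ^ suc (suc (suc v)) * k
        ≈⟨ mod-by k refl ⟩
      1# + P ^ suc (suc v) * y ∎
      where
      open ≈[mod]-Reasoning (P ^ suc (suc (suc v)))
      open _≈_[mod_] (1+py-^[p^v] y v) renaming (quotient to k; ≈+multiple to IH)
      w = P ^ v * (y + P * k)

    1+py-^[cp^v] : ∀ y c v → (1# + P * y) ^ (c ℕ.* p ℕ.^ v) ≈ 1# + ι (c ℕ.* p ℕ.^ suc v) * y [mod ι (p ℕ.^ suc (suc v)) ]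
    1+py-^[cp^v] y c v = ≈[mod]-divisor (trans (*-identityʳ _) (ι-^ p (suc (suc v)))) (begin
      (1# + P * y) ^ (c ℕ.* p ℕ.^ v)      ≈⟨ ≈⇒≈[mod] _ (^-* (1# + P * y) c (p ℕ.^ v)) ⟩
      ((1# + P * y) ^ (p ℕ.^ v)) ^ c      ≈⟨ ≈[mod]-^ (1+py-^[p^v] y v) c ⟩
      (1# + P ^ suc v * y) ^ c            ≈⟨ ≈[mod]-divisor (solve 3 (λ P Q y → P :* (P :* Q) :* (Q :* y :* y) := P :* Q :* y :* (P :* Q :* y))
                                                                     refl P (P ^ v) y)
                                                            (1+x-^ (P ^ suc v * y) c) ⟩
      1# + ι c * (P ^ suc v * y)          ≈⟨ ≈⇒≈[mod] _ (+-congˡ (trans (sym (*-assoc (ι c) (P ^ suc v) y))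
                                             (*-congʳ (trans (*-congˡ (sym (ι-^ p (suc v)))) (sym (ι-* c (p ℕ.^ suc v))))))) ⟩
      1# + ι (c ℕ.* p ℕ.^ suc v) * y      ∎)
      where open ≈[mod]-Reasoning (P ^ suc (suc v))

  frobenius : ∀ {p} → Prime p → ∀ x y → (x + y) ^ p ≈ x ^ p + y ^ p [mod ι p ]
  frobenius {zero}    pr = ⊥-elim (¬prime[0] pr)
  frobenius {suc p-1} pr x y = mod-by (sum w) (begin
    (x + y) ^ p                                         ≈⟨ theorem p x y ⟩
    t Fin.zero + sum (tail t)                           ≈⟨ +-congˡ (sum-init-last (tail t)) ⟩
    t Fin.zero + (sum (init (tail t)) + last (tail t))  ≈⟨ +-cong first (+-cong middle final) ⟩
    y ^ p + (ι p * sum w + x ^ p)                       ≈⟨ solve 4 (λ X Y P W → Y :+ (P :* W :+ X) := X :+ Y :+ P :* W)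
                                                                   refl (x ^ p) (y ^ p) (ι p) (sum w) ⟩
    x ^ p + y ^ p + ι p * sum w                         ∎)
    where
    open ≈-Reasoning
    p = suc p-1
    t = binomialTerm x y p
    j : Fin p-1 → ℕ
    j i = suc (toℕ (inject₁ i))
    p∣pCj : ∀ i → p ∣ p C j i
    p∣pCj i = prime∣pCk pr z<s (s≤s (≡.subst (_< p-1) (≡.sym (FinP.toℕ-inject₁ i)) (FinP.toℕ<n i)))
    w : Fin p-1 → Carrier
    w i = ι (_∣_.quotient (p∣pCj i)) * (x ^ j i * y ^ (p ∸ j i))
    first : t Fin.zero ≈ y ^ p
    first = trans (+-identityʳ _) (*-identityˡ (y ^ p))
    middle : sum (init (tail t)) ≈ ι p * sum w
    middle = begin
      sum (init (tail t))   ≈⟨ sum-cong-≋ (λ i → trans (·≈ι* (p C j i) _) (trans (*-congʳ (ι-multiple (p∣pCj i))) (*-assoc _ _ _))) ⟩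
      sum (λ i → ι p * w i) ≈⟨ *-distribˡ-sum (ι p) w ⟨
      ι p * sum w           ∎
      where
      ι-multiple : ∀ {m} (p∣m : p ∣ m) → ι m ≈ ι p * ι (_∣_.quotient p∣m)
      ι-multiple (divides q m≡qp) = trans (reflexive (cong ι m≡qp)) (trans (ι-* q p) (*-comm (ι q) (ι p)))
    final : last (tail t) ≈ x ^ p
    final = top (cong suc (FinP.toℕ-fromℕ p-1))
      where
      top : ∀ {k} → k ≡ p → (p C k) · (x ^ k * y ^ (p ∸ k)) ≈ x ^ p
      top ≡.refl rewrite nCn≡1 p | ℕP.n∸n≡0 p = trans (+-identityʳ _) (*-identityʳ (x ^ p))

  1-y-^p : ∀ {p} → Prime p → ∀ y → (1# - y) ^ p ≈ 1# - y ^ p [mod ι p ]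
  1-y-^p {p} pr y = begin
    (1# - y) ^ p                      ≈⟨ ≈⇒≈[mod] _ (trans (sym (+-identityʳ _)) (+-congˡ (sym (-‿inverseʳ (y ^ p))))) ⟩
    (1# - y) ^ p + (y ^ p - y ^ p)    ≈⟨ ≈⇒≈[mod] _ (sym (+-assoc _ _ _)) ⟩
    (1# - y) ^ p + y ^ p - y ^ p      ≈⟨ ≈[mod]-+ (≈[mod]-sym (frobenius pr (1# - y) y)) (≈⇒≈[mod] _ refl) ⟩
    (1# - y + y) ^ p - y ^ p          ≈⟨ ≈⇒≈[mod] _ (+-congʳ (trans (^-congˡ p 1-y+y≈1) (1#-^ p))) ⟩
    1# - y ^ p                        ∎
    where
    open ≈[mod]-Reasoning (ι p)
    1-y+y≈1 : 1# - y + y ≈ 1#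
    1-y+y≈1 = trans (+-assoc 1# (- y) y) (trans (+-congˡ (-‿inverseˡ y)) (+-identityʳ 1#))

  geometric-inverse : ∀ {g y} → g ≈ 1# + y * g → g * (1# - y) ≈ 1#
  geometric-inverse {g} {y} g≈1+yg = begin
    g * (1# - y)               ≈⟨ distribˡ g 1# (- y) ⟩
    g * 1# + g * - y           ≈⟨ +-cong (*-identityʳ g) (trans (sym (-‿distribʳ-* g y)) (-‿cong (*-comm g y))) ⟩
    g - y * g                  ≈⟨ +-congʳ g≈1+yg ⟩
    1# + y * g - y * g         ≈⟨ +-assoc 1# (y * g) (- (y * g)) ⟩
    1# + (y * g - y * g)       ≈⟨ +-congˡ (-‿inverseʳ (y * g)) ⟩
    1# + 0#                    ≈⟨ +-identityʳ 1# ⟩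
    1#                         ∎
    where open ≈-Reasoning

  inverse-* : ∀ {a b c d} → a * b ≈ 1# → c * d ≈ 1# → (a * c) * (b * d) ≈ 1#
  inverse-* {a} {b} {c} {d} ab≈1 cd≈1 = begin
    a * c * (b * d)   ≈⟨ solve 4 (λ a c b d → a :* c :* (b :* d) := a :* b :* (c :* d)) refl a c b d ⟩
    a * b * (c * d)   ≈⟨ *-cong ab≈1 cd≈1 ⟩
    1# * 1#           ≈⟨ *-identityʳ 1# ⟩
    1#                ∎
    where open ≈-Reasoning

  inverses-≈[mod] : ∀ {a b c d m} → a * b ≈ 1# → c * d ≈ 1# → b ≈ d [mod m ] → a ≈ c [mod m ]
  inverses-≈[mod] {a} {b} {c} {d} {m} ab≈1 cd≈1 b≡d = begin
    a             ≈⟨ ≈⇒≈[mod] m (trans (sym (*-identityʳ a)) (*-congˡ (sym cd≈1))) ⟩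
    a * (c * d)   ≈⟨ ≈⇒≈[mod] m (solve 3 (λ a c d → a :* (c :* d) := c :* (a :* d)) refl a c d) ⟩
    c * (a * d)   ≈⟨ ≈[mod]-* (≈⇒≈[mod] m refl) (≈[mod]-* (≈⇒≈[mod] m refl) (≈[mod]-sym b≡d)) ⟩
    c * (a * b)   ≈⟨ ≈⇒≈[mod] m (trans (*-congˡ ab≈1) (*-identityʳ c)) ⟩
    c             ∎
    where open ≈[mod]-Reasoning m

  ∏< : ℕ → (ℕ → Carrier) → Carrier
  ∏< zero    f = 1#
  ∏< (suc N) f = ∏< N f * f N

  ∏<-inverse : ∀ {f g} N → (∀ i → f i * g i ≈ 1#) → ∏< N f * ∏< N g ≈ 1#
  ∏<-inverse zero    fg≈1 = *-identityʳ 1#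
  ∏<-inverse (suc N) fg≈1 = inverse-* (∏<-inverse N fg≈1) (fg≈1 N)

  ∏<-^ : ∀ (f : ℕ → Carrier) b a N → ∏< N (λ i → f i ^ (b ℕ.* a)) ≈ ∏< N (λ i → f i ^ b) ^ a
  ∏<-^ f b a zero    = sym (1#-^ a)
  ∏<-^ f b a (suc N) = begin
    ∏< N (λ i → f i ^ (b ℕ.* a)) * f N ^ (b ℕ.* a)   ≈⟨ *-cong (∏<-^ f b a N) (sym (^-assocʳ (f N) b a)) ⟩
    ∏< N (λ i → f i ^ b) ^ a * (f N ^ b) ^ a          ≈⟨ ^-distrib-* (∏< N (λ i → f i ^ b)) (f N ^ b) a ⟨
    (∏< N (λ i → f i ^ b) * f N ^ b) ^ a              ∎
    where
    open ≈-Reasoning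
    open import Algebra.Properties.CommutativeSemiring.Exp commutativeSemiring using (^-distrib-*)

-- Residues of rationals modulo p

module _ where

  open Data.Integer using (_+_; _*_; -_; _-_)
  open ≡ using (trans; sym)

  ↧ₙ[i/n]∣n : ∀ i n .{{_ : NonZero n}} → ↧ₙ (i ℚ./ n) ∣ n
  ↧ₙ[i/n]∣n i n = divides (ℕGCD.gcd ℤ.∣ i ∣ n) (ℤP.+-injective (begin
    + n                                     ≡⟨ ℚP.↧-/ i n ⟨
    ↧ (i ℚ./ n) * + ℕGCD.gcd ℤ.∣ i ∣ n      ≡⟨ ℤP.*-comm (↧ (i ℚ./ n)) (+ ℕGCD.gcd ℤ.∣ i ∣ n) ⟩
    + ℕGCD.gcd ℤ.∣ i ∣ n * ↧ (i ℚ./ n)      ≡⟨ ℤP.pos-* (ℕGCD.gcd ℤ.∣ i ∣ n) (↧ₙ (i ℚ./ n)) ⟨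
    + (ℕGCD.gcd ℤ.∣ i ∣ n ℕ.* ↧ₙ (i ℚ./ n)) ∎))
    where open ≡.≡-Reasoning

  same-residue : ∀ {p} → Prime p → ∀ (W E₁ E₂ : ℤ) {c₁ c₂ q₁ q₂ k₁ k₂} → ¬ p ∣ c₁ → ¬ p ∣ c₂ →
                 suc k₁ ≡ c₁ ℕ.* q₁ → suc k₂ ≡ c₂ ℕ.* q₂ →
                 ((+ (c₁ ℕ.* q₁) * W + + (p ℕ.* q₁) * E₁) ℚ./ suc k₁)
                   ≡ ((+ (c₂ ℕ.* q₂) * W + + (p ℕ.* q₂) * E₂) ℚ./ suc k₂) [modℚ p ]
  same-residue {p} pr W E₁ E₂ {suc c₁-1} {suc c₂-1} {q₁} {q₂} {k₁} {k₂} p∤c₁ p∤c₂ N₁≡ N₂≡ = t , p∤↧t , difference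
    where
    c₁ = suc c₁-1
    c₂ = suc c₂-1
    T = E₁ * + c₂ - E₂ * + c₁
    t = T ℚ./ (c₁ ℕ.* c₂)
    D₁ = + (c₁ ℕ.* q₁) * W + + (p ℕ.* q₁) * E₁
    D₂ = + (c₂ ℕ.* q₂) * W + + (p ℕ.* q₂) * E₂

    p∤↧t : ¬ p ∣ ↧ₙ t
    p∤↧t p∣↧t with euclidsLemma c₁ c₂ pr (∣-trans p∣↧t (↧ₙ[i/n]∣n T (c₁ ℕ.* c₂)))
    ... | inj₁ p∣c₁ = p∤c₁ p∣c₁
    ... | inj₂ p∣c₂ = p∤c₂ p∣c₂

    ↑ : ∀ {k c q} → suc k ≡ c ℕ.* q → + suc k ≡ + c * + q
    ↑ {c = c} eq = trans (cong +_ eq) (ℤP.pos-* c _)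

    cross-multiplied : (D₁ * + suc k₂ + (- D₂) * + suc k₁) * (+ 1 * (+ c₁ * + c₂))
                     ≡ (+ p * T) * (+ suc k₁ * + suc k₂)
    cross-multiplied = begin
      (D₁ * + suc k₂ + (- D₂) * + suc k₁) * (+ 1 * (+ c₁ * + c₂))
        ≡⟨ cong₂ (λ a b → (D₁ * a + (- D₂) * b) * (+ 1 * (+ c₁ * + c₂))) (↑ {k₂} {c₂} {q₂} N₂≡) (↑ {k₁} {c₁} {q₁} N₁≡) ⟩
      (D₁ * (+ c₂ * + q₂) + (- D₂) * (+ c₁ * + q₁)) * (+ 1 * (+ c₁ * + c₂))
        ≡⟨ cong₂ (λ a b → (a * (+ c₂ * + q₂) + (- b) * (+ c₁ * + q₁)) * (+ 1 * (+ c₁ * + c₂)))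
                 (expand c₁ q₁ E₁) (expand c₂ q₂ E₂) ⟩
      _ ≡⟨ identity (+ p) (+ c₁) (+ c₂) (+ q₁) (+ q₂) W E₁ E₂ ⟩
      (+ p * T) * ((+ c₁ * + q₁) * (+ c₂ * + q₂))
        ≡⟨ cong₂ (λ a b → (+ p * T) * (a * b)) (↑ {k₁} {c₁} {q₁} N₁≡) (↑ {k₂} {c₂} {q₂} N₂≡) ⟨
      (+ p * T) * (+ suc k₁ * + suc k₂) ∎
      where
      open ≡.≡-Reasoning
      expand : ∀ c q E → + (c ℕ.* q) * W + + (p ℕ.* q) * E ≡ + c * + q * W + + p * + q * E
      expand c q E = cong₂ (λ a b → a * W + b * E) (ℤP.pos-* c q) (ℤP.pos-* p q)
      identity : ∀ P c₁ c₂ q₁ q₂ W E₁ E₂ →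
        ((c₁ * q₁ * W + P * q₁ * E₁) * (c₂ * q₂) + (- (c₂ * q₂ * W + P * q₂ * E₂)) * (c₁ * q₁)) * (+ 1 * (c₁ * c₂))
        ≡ (P * (E₁ * c₂ - E₂ * c₁)) * ((c₁ * q₁) * (c₂ * q₂))
      identity = ℤ-Solver.solve-∀

    difference : D₁ ℚ./ suc k₁ ℚ.- D₂ ℚ./ suc k₂ ≡ (+ p ℚ./ 1) ℚ.* t
    difference = ℚP.toℚᵘ-injective (begin
      toℚᵘ (D₁ ℚ./ suc k₁ ℚ.- D₂ ℚ./ suc k₂)
        ≈⟨ ℚP.toℚᵘ-homo-+ (D₁ ℚ./ suc k₁) (ℚ.- (D₂ ℚ./ suc k₂)) ⟩
      toℚᵘ (D₁ ℚ./ suc k₁) ℚᵘ.+ toℚᵘ (ℚ.- (D₂ ℚ./ suc k₂))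
        ≈⟨ ℚᵘP.+-cong (ℚP.toℚᵘ-fromℚᵘ (mkℚᵘ D₁ k₁))
                      (ℚᵘP.≃-trans (ℚP.toℚᵘ-homo‿- (D₂ ℚ./ suc k₂)) (ℚᵘP.-‿cong (ℚP.toℚᵘ-fromℚᵘ (mkℚᵘ D₂ k₂)))) ⟩
      mkℚᵘ D₁ k₁ ℚᵘ.- mkℚᵘ D₂ k₂
        ≈⟨ *≡* cross-multiplied ⟩
      mkℚᵘ (+ p) 0 ℚᵘ.* (T ℚᵘ./ (c₁ ℕ.* c₂))
        ≈⟨ ℚᵘP.*-cong (ℚP.toℚᵘ-fromℚᵘ (mkℚᵘ (+ p) 0)) (ℚP.toℚᵘ-fromℚᵘ (T ℚᵘ./ (c₁ ℕ.* c₂))) ⟨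
      toℚᵘ (+ p ℚ./ 1) ℚᵘ.* toℚᵘ t
        ≈⟨ ℚP.toℚᵘ-homo-* (+ p ℚ./ 1) t ⟨
      toℚᵘ ((+ p ℚ./ 1) ℚ.* t) ∎)
      where open ℚᵘP.≃-Reasoning

  -- D m / (p m) = W + p E / c, whose residue modulo p is W.
  ResidueForm : ℕ → ℤ → (ℕ → ℤ) → Set
  ResidueForm p W D = ∀ m → 0 ℕ.< m → ∃₂ λ c q → ∃ λ E →
    ¬ p ∣ c × p ℕ.* m ≡ c ℕ.* q × D m ≡ + (c ℕ.* q) * W + + (p ℕ.* q) * E

  ResidueForm-cong : ∀ {p W D D′} → (∀ m → 0 ℕ.< m → D m ≡ D′ m) → ResidueForm p W D′ → ResidueForm p W D
  ResidueForm-cong D≡D′ form m 0<m with form m 0<m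
  ... | c , q , E , p∤c , pm≡cq , D′m≡ = c , q , E , p∤c , pm≡cq , trans (D≡D′ m 0<m) D′m≡

  ResidueForm-negate : ∀ {p W D} → ResidueForm p W D → ResidueForm p (- W) (λ m → - D m)
  ResidueForm-negate {p} {W} form m 0<m with form m 0<m
  ... | c , q , E , p∤c , pm≡cq , Dm≡ = c , q , - E , p∤c , pm≡cq , trans (cong -_ Dm≡) (negate (+ (c ℕ.* q)) (+ (p ℕ.* q)) W E)
    where
    negate : ∀ a b W E → - (a * W + b * E) ≡ a * - W + b * - E
    negate = ℤ-Solver.solve-∀

  ResidueForm-congruent : ∀ {p W D} → Prime p → ResidueForm p W D → ∀ {m₁ m₂ k₁ k₂} → 0 ℕ.< m₁ → 0 ℕ.< m₂ →
                          suc k₁ ≡ p ℕ.* m₁ → suc k₂ ≡ p ℕ.* m₂ → (D m₁ ℚ./ suc k₁) ≡ (D m₂ ℚ./ suc k₂) [modℚ p ]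
  ResidueForm-congruent {W = W} pr form {m₁} {m₂} 0<m₁ 0<m₂ N₁≡ N₂≡ with form m₁ 0<m₁ | form m₂ 0<m₂
  ... | c₁ , q₁ , E₁ , p∤c₁ , pm₁≡ , Dm₁≡ | c₂ , q₂ , E₂ , p∤c₂ , pm₂≡ , Dm₂≡ rewrite Dm₁≡ | Dm₂≡ =
    same-residue pr W E₁ E₂ p∤c₁ p∤c₂ (trans N₁≡ pm₁≡) (trans N₂≡ pm₂≡)

-- The ring of formal power series over ℤ

module _ where

  open Data.Integer using (_+_; _*_; -_)
  open ≡ using (refl; sym; trans)

  ∑< : ℕ → (ℕ → ℤ) → ℤ
  ∑< zero    h = + 0
  ∑< (suc m) h = h 0 + ∑< m (h ∘ suc)

  sumℤ-applyUpTo : ∀ (h : ℕ → ℤ) f m → sumℤ (map h (applyUpTo f m)) ≡ ∑< m (h ∘ f)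
  sumℤ-applyUpTo h f zero    = refl
  sumℤ-applyUpTo h f (suc m) = cong (_+_ (h (f 0))) (sumℤ-applyUpTo h (f ∘ suc) m)

  ∑<-cong : ∀ {h h'} m → (∀ i → i < m → h i ≡ h' i) → ∑< m h ≡ ∑< m h'
  ∑<-cong zero    eq = refl
  ∑<-cong (suc m) eq = cong₂ _+_ (eq 0 (s≤s z≤n)) (∑<-cong m (λ i i<m → eq (suc i) (s≤s i<m)))

  ∑<-+ : ∀ h h' m → ∑< m (λ i → h i + h' i) ≡ ∑< m h + ∑< m h'
  ∑<-+ h h' zero    = refl
  ∑<-+ h h' (suc m) = trans (cong (_+_ (h 0 + h' 0)) (∑<-+ (h ∘ suc) (h' ∘ suc) m))
                            (interchange (h 0) (h' 0) _ _)
    where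
    interchange : ∀ a b c d → a + b + (c + d) ≡ a + c + (b + d)
    interchange = ℤ-Solver.solve-∀

  ∑<-*ˡ : ∀ c h m → ∑< m (λ i → c * h i) ≡ c * ∑< m h
  ∑<-*ˡ c h zero    = sym (ℤP.*-zeroʳ c)
  ∑<-*ˡ c h (suc m) = trans (cong (_+_ (c * h 0)) (∑<-*ˡ c (h ∘ suc) m)) (sym (ℤP.*-distribˡ-+ c (h 0) _))

  ∑<-zero : ∀ m → ∑< m (λ _ → + 0) ≡ + 0
  ∑<-zero zero    = refl
  ∑<-zero (suc m) = trans (ℤP.+-identityˡ _) (∑<-zero m)

  ∑<-last : ∀ h m → ∑< (suc m) h ≡ ∑< m h + h m
  ∑<-last h zero    = ℤP.+-comm (h 0) (+ 0)
  ∑<-last h (suc m) = trans (cong (_+_ (h 0)) (∑<-last (h ∘ suc) m)) (sym (ℤP.+-assoc (h 0) _ _))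

  ⋆-coeff : ∀ f g n → (f ⋆ g) n ≡ ∑< (suc n) (λ i → f i * g (n ∸ i))
  ⋆-coeff f g n = sumℤ-applyUpTo (λ i → f i * g (n ∸ i)) (λ i → i) (suc n)

  infixl 6 _⊕_

  _⊕_ : Series → Series → Series
  (f ⊕ g) n = f n + g n

  ⊖_ : Series → Series
  (⊖ f) n = - f n

  zeroS : Series
  zeroS _ = + 0

  shift : Series → Series
  shift f n = f (suc n)

  scale : ℤ → Series → Series
  scale c f n = c * f n

  ⋆-cong : ∀ {f f' g g'} → f ≗ f' → g ≗ g' → f ⋆ g ≗ f' ⋆ g'
  ⋆-cong {f} {f'} {g} {g'} f≗f' g≗g' n = begin
    (f ⋆ g) n                                 ≡⟨ ⋆-coeff f g n ⟩
    ∑< (suc n) (λ i → f i * g (n ∸ i))        ≡⟨ ∑<-cong (suc n) (λ i _ → cong₂ _*_ (f≗f' i) (g≗g' (n ∸ i))) ⟩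
    ∑< (suc n) (λ i → f' i * g' (n ∸ i))      ≡⟨ ⋆-coeff f' g' n ⟨
    (f' ⋆ g') n                               ∎
    where open ≡.≡-Reasoning

  ⋆-distribˡ : ∀ f g h → f ⋆ (g ⊕ h) ≗ f ⋆ g ⊕ f ⋆ h
  ⋆-distribˡ f g h n = begin
    (f ⋆ (g ⊕ h)) n                                               ≡⟨ ⋆-coeff f (g ⊕ h) n ⟩
    ∑< (suc n) (λ i → f i * (g (n ∸ i) + h (n ∸ i)))              ≡⟨ ∑<-cong (suc n) (λ i _ → ℤP.*-distribˡ-+ (f i) (g (n ∸ i)) (h (n ∸ i))) ⟩
    ∑< (suc n) (λ i → f i * g (n ∸ i) + f i * h (n ∸ i))          ≡⟨ ∑<-+ (λ i → f i * g (n ∸ i)) (λ i → f i * h (n ∸ i)) (suc n) ⟩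
    ∑< (suc n) (λ i → f i * g (n ∸ i)) + ∑< (suc n) (λ i → f i * h (n ∸ i))
                                                                  ≡⟨ cong₂ _+_ (⋆-coeff f g n) (⋆-coeff f h n) ⟨
    (f ⋆ g ⊕ f ⋆ h) n                                             ∎
    where open ≡.≡-Reasoning

  scale-⋆ : ∀ c f g → scale c f ⋆ g ≗ scale c (f ⋆ g)
  scale-⋆ c f g n = begin
    (scale c f ⋆ g) n                               ≡⟨ ⋆-coeff (scale c f) g n ⟩
    ∑< (suc n) (λ i → c * f i * g (n ∸ i))          ≡⟨ ∑<-cong (suc n) (λ i _ → ℤP.*-assoc c (f i) (g (n ∸ i))) ⟩
    ∑< (suc n) (λ i → c * (f i * g (n ∸ i)))        ≡⟨ ∑<-*ˡ c (λ i → f i * g (n ∸ i)) (suc n) ⟩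
    c * ∑< (suc n) (λ i → f i * g (n ∸ i))          ≡⟨ cong (c *_) (⋆-coeff f g n) ⟨
    scale c (f ⋆ g) n                               ∎
    where open ≡.≡-Reasoning

  zeroS-⋆ : ∀ f → zeroS ⋆ f ≗ zeroS
  zeroS-⋆ f n = trans (⋆-coeff zeroS f n) (trans (∑<-cong (suc n) (λ i _ → ℤP.*-zeroˡ (f (n ∸ i)))) (∑<-zero (suc n)))

  ⋆-sucˡ : ∀ f g n → (f ⋆ g) (suc n) ≡ f 0 * g (suc n) + (shift f ⋆ g) n
  ⋆-sucˡ f g n = trans (⋆-coeff f g (suc n)) (cong (_+_ (f 0 * g (suc n))) (sym (⋆-coeff (shift f) g n)))

  ⋆-sucʳ : ∀ f g n → (f ⋆ g) (suc n) ≡ (f ⋆ shift g) n + f (suc n) * g 0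
  ⋆-sucʳ f g n = begin
    (f ⋆ g) (suc n)                                                      ≡⟨ ⋆-coeff f g (suc n) ⟩
    ∑< (suc (suc n)) (λ i → f i * g (suc n ∸ i))                         ≡⟨ ∑<-last (λ i → f i * g (suc n ∸ i)) (suc n) ⟩
    ∑< (suc n) (λ i → f i * g (suc n ∸ i)) + f (suc n) * g (suc n ∸ suc n)
        ≡⟨ cong₂ _+_ (∑<-cong (suc n) (λ i i≤n → cong (λ k → f i * g k) (ℕP.+-∸-assoc 1 (ℕP.≤-pred i≤n))))
                     (cong (λ k → f (suc n) * g k) (ℕP.n∸n≡0 n)) ⟩
    ∑< (suc n) (λ i → f i * shift g (n ∸ i)) + f (suc n) * g 0           ≡⟨ cong (_+ f (suc n) * g 0) (⋆-coeff f (shift g) n) ⟨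
    (f ⋆ shift g) n + f (suc n) * g 0                                    ∎
    where open ≡.≡-Reasoning

  ⋆-comm : ∀ f g → f ⋆ g ≗ g ⋆ f
  ⋆-comm f g zero    = cong (_+ + 0) (ℤP.*-comm (f 0) (g 0))
  ⋆-comm f g (suc n) = begin
    (f ⋆ g) (suc n)                          ≡⟨ ⋆-sucˡ f g n ⟩
    f 0 * g (suc n) + (shift f ⋆ g) n        ≡⟨ cong₂ _+_ (ℤP.*-comm (f 0) (g (suc n))) (⋆-comm (shift f) g n) ⟩
    g (suc n) * f 0 + (g ⋆ shift f) n        ≡⟨ ℤP.+-comm (g (suc n) * f 0) _ ⟩
    (g ⋆ shift f) n + g (suc n) * f 0        ≡⟨ ⋆-sucʳ g f n ⟨
    (g ⋆ f) (suc n)                          ∎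
    where open ≡.≡-Reasoning

  oneS-⋆ : ∀ f → oneS ⋆ f ≗ f
  oneS-⋆ f zero    = trans (ℤP.+-identityʳ _) (ℤP.*-identityˡ (f 0))
  oneS-⋆ f (suc n) = trans (⋆-sucˡ oneS f n) (trans (cong₂ _+_ (ℤP.*-identityˡ (f (suc n))) (zeroS-⋆ f n)) (ℤP.+-identityʳ _))

  ⋆-assoc : ∀ f g h → (f ⋆ g) ⋆ h ≗ f ⋆ (g ⋆ h)
  ⋆-assoc f g h zero    = regroup (f 0) (g 0) (h 0)
    where
    regroup : ∀ a b c → (a * b + + 0) * c + + 0 ≡ a * (b * c + + 0) + + 0
    regroup = ℤ-Solver.solve-∀
  ⋆-assoc f g h (suc n) = begin
    ((f ⋆ g) ⋆ h) (suc n)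
      ≡⟨ ⋆-sucˡ (f ⋆ g) h n ⟩
    (f ⋆ g) 0 * h (suc n) + (shift (f ⋆ g) ⋆ h) n
      ≡⟨ cong (_+_ ((f ⋆ g) 0 * h (suc n))) (trans (⋆-cong {g = h} {g' = h} (⋆-sucˡ f g) (λ _ → refl) n)
                                                (trans (⋆-comm (scale (f 0) (shift g) ⊕ shift f ⋆ g) h n) (⋆-distribˡ h (scale (f 0) (shift g)) (shift f ⋆ g) n))) ⟩
    (f ⋆ g) 0 * h (suc n) + ((h ⋆ scale (f 0) (shift g)) n + (h ⋆ (shift f ⋆ g)) n)
      ≡⟨ cong₂ (λ a b → (f ⋆ g) 0 * h (suc n) + (a + b))
               (trans (⋆-comm h (scale (f 0) (shift g)) n) (scale-⋆ (f 0) (shift g) h n))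
               (trans (⋆-comm h (shift f ⋆ g) n) (⋆-assoc (shift f) g h n)) ⟩
    (f 0 * g 0 + + 0) * h (suc n) + (f 0 * (shift g ⋆ h) n + (shift f ⋆ (g ⋆ h)) n)
      ≡⟨ regroup (f 0) (g 0) (h (suc n)) _ _ ⟩
    f 0 * (g 0 * h (suc n) + (shift g ⋆ h) n) + (shift f ⋆ (g ⋆ h)) n
      ≡⟨ cong (λ z → f 0 * z + (shift f ⋆ (g ⋆ h)) n) (⋆-sucˡ g h n) ⟨
    f 0 * (g ⋆ h) (suc n) + (shift f ⋆ (g ⋆ h)) n
      ≡⟨ ⋆-sucˡ f (g ⋆ h) n ⟨
    (f ⋆ (g ⋆ h)) (suc n) ∎
    where
    open ≡.≡-Reasoning
    regroup : ∀ a b c d e → (a * b + + 0) * c + (a * d + e) ≡ a * (b * c + d) + e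
    regroup = ℤ-Solver.solve-∀

  -- A record rather than _≗_, so that unification can recover the two series being compared.
  infix 4 _≈ₛ_

  record _≈ₛ_ (f g : Series) : Set where
    constructor pointwise
    field coeff : f ≗ g

  open _≈ₛ_ public

  seriesRing : CommutativeRing _ _
  seriesRing = record
    { Carrier = Series
    ; _≈_ = _≈ₛ_
    ; _+_ = _⊕_
    ; _*_ = _⋆_
    ; -_ = ⊖_
    ; 0# = zeroS
    ; 1# = oneS
    ; isCommutativeRing = record
      { isRing = record
        { +-isAbelianGroup = record
          { isGroup = record
            { isMonoid = record
              { isSemigroup = record
                { isMagma = record
                  { isEquivalence = record
                    { refl = pointwise (λ _ → refl)
                    ; sym = λ e → pointwise (λ n → sym (coeff e n))
                    ; trans = λ e e' → pointwise (λ n → trans (coeff e n) (coeff e' n)) }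
                  ; ∙-cong = λ e e' → pointwise (λ n → cong₂ _+_ (coeff e n) (coeff e' n)) }
                ; assoc = λ f g h → pointwise (λ n → ℤP.+-assoc (f n) (g n) (h n)) }
              ; identity = (λ f → pointwise (λ n → ℤP.+-identityˡ (f n))) , (λ f → pointwise (λ n → ℤP.+-identityʳ (f n))) }
            ; inverse = (λ f → pointwise (λ n → ℤP.+-inverseˡ (f n))) , (λ f → pointwise (λ n → ℤP.+-inverseʳ (f n)))
            ; ⁻¹-cong = λ e → pointwise (λ n → cong -_ (coeff e n)) }
          ; comm = λ f g → pointwise (λ n → ℤP.+-comm (f n) (g n)) }
        ; *-cong = λ e e' → pointwise (⋆-cong (coeff e) (coeff e'))
        ; *-assoc = λ f g h → pointwise (⋆-assoc f g h)
        ; *-identity = (λ f → pointwise (oneS-⋆ f)) , (λ f → pointwise (λ n → trans (⋆-comm f oneS n) (oneS-⋆ f n)))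
        ; distrib = (λ f g h → pointwise (⋆-distribˡ f g h))
                  , (λ f g h → pointwise (λ n → trans (⋆-comm (g ⊕ h) f n)
                                           (trans (⋆-distribˡ f g h n) (cong₂ _+_ (⋆-comm f g n) (⋆-comm f h n))))) }
      ; *-comm = λ f g → pointwise (⋆-comm f g) }
    }

-- The generating series of d_m

module _ where

  open CommutativeRing seriesRing
    using (_+_; _*_; -_; _-_; 1#; _≈_; refl; reflexive; sym; trans; -‿cong; *-cong; *-congˡ; *-congʳ; +-congˡ; *-assoc; *-identityʳ; distribʳ; setoid)
  open import Algebra.Definitions.RawSemiring (Semiring.rawSemiring (CommutativeRing.semiring seriesRing)) using (_^_)
  open Congruence seriesRing

  monomial : ℕ → Series
  monomial k n = if n ≡ᵇ k then + 1 else + 0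

  monomial-zero : monomial 0 ≗ oneS
  monomial-zero zero    = ≡.refl
  monomial-zero (suc n) = ≡.refl

  shiftBy : ℕ → Series → Series
  shiftBy zero    f n       = f n
  shiftBy (suc k) f zero    = + 0
  shiftBy (suc k) f (suc n) = shiftBy k f n

  shiftBy-below : ∀ k f n → n < k → shiftBy k f n ≡ + 0
  shiftBy-below (suc k) f zero    _         = ≡.refl
  shiftBy-below (suc k) f (suc n) (s≤s n<k) = shiftBy-below k f n n<k

  shiftBy-+ : ∀ k f m → shiftBy k f (k ℕ.+ m) ≡ f m
  shiftBy-+ zero    f m = ≡.refl
  shiftBy-+ (suc k) f m = shiftBy-+ k f m

  monomial-⋆ : ∀ k f → monomial k ⋆ f ≗ shiftBy k f
  monomial-⋆ zero    f n = ≡.trans (⋆-cong {g = f} {g' = f} monomial-zero (λ _ → ≡.refl) n) (oneS-⋆ f n)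
  monomial-⋆ (suc k) f zero    = ≡.trans (ℤP.+-identityʳ _) (ℤP.*-zeroˡ (f 0))
  monomial-⋆ (suc k) f (suc n) = ≡.trans (⋆-sucˡ (monomial (suc k)) f n)
    (≡.trans (cong₂ ℤ._+_ (ℤP.*-zeroˡ (f (suc n))) (monomial-⋆ k f n)) (ℤP.+-identityˡ _))

  monomial-*-monomial : ∀ a b → monomial a * monomial b ≈ monomial (a ℕ.+ b)
  monomial-*-monomial a b = pointwise (λ n → ≡.trans (monomial-⋆ a (monomial b) n) (shiftBy-monomial a n))
    where
    shiftBy-monomial : ∀ a → shiftBy a (monomial b) ≗ monomial (a ℕ.+ b)
    shiftBy-monomial zero    n       = ≡.refl
    shiftBy-monomial (suc a) zero    = ≡.refl
    shiftBy-monomial (suc a) (suc n) = shiftBy-monomial a n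

  monomial-^ : ∀ k n → monomial k ^ n ≈ monomial (n ℕ.* k)
  monomial-^ k zero    = pointwise (≡.sym ∘ monomial-zero)
  monomial-^ k (suc n) = trans (*-congˡ {monomial k} (monomial-^ k n)) (monomial-*-monomial k (n ℕ.* k))

  oneMinus≈1-monomial : ∀ {K} → 0 < K → oneMinus K ≈ 1# - monomial K
  oneMinus≈1-monomial {suc k} _ = pointwise coefficients
    where
    coefficients : oneMinus (suc k) ≗ 1# - monomial (suc k)
    coefficients zero = ≡.refl
    coefficients (suc n) with suc n ≡ᵇ suc k
    ... | true  = ≡.refl
    ... | false = ≡.refl

  geomInv-below : ∀ K n → n < K → geomInv K n ≡ oneS n
  geomInv-below K zero    _   with K ∣? 0
  ... | yes _   = ≡.refl
  ... | no K∤0 = ⊥-elim (K∤0 (divides 0 ≡.refl))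
  geomInv-below K (suc n) n<K with K ∣? suc n
  ... | yes K∣n = ⊥-elim (ℕP.<⇒≱ n<K (∣⇒≤ K∣n))
  ... | no _    = ≡.refl

  geomInv-periodic : ∀ K m → geomInv K (K ℕ.+ m) ≡ geomInv K m
  geomInv-periodic K m with K ∣? (K ℕ.+ m) | K ∣? m
  ... | yes _     | yes _   = ≡.refl
  ... | no  _     | no  _   = ≡.refl
  ... | yes K∣K+m | no K∤m  = ⊥-elim (K∤m (∣m+n∣m⇒∣n K∣K+m ∣-refl))
  ... | no K∤K+m  | yes K∣m = ⊥-elim (K∤K+m (∣m∣n⇒∣m+n ∣-refl K∣m))

  geomInv-unfold : ∀ {K} → 0 < K → geomInv K ≈ 1# + monomial K * geomInv K
  geomInv-unfold {K} 0<K = pointwise coefficients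
    where
    open ≡.≡-Reasoning
    coefficients : geomInv K ≗ 1# + monomial K * geomInv K
    coefficients n with ℕP.<-≤-connex n K
    ... | inj₁ n<K = begin
      geomInv K n                          ≡⟨ geomInv-below K n n<K ⟩
      oneS n                               ≡⟨ ℤP.+-identityʳ (oneS n) ⟨
      oneS n ℤ.+ + 0                       ≡⟨ cong (ℤ._+_ (oneS n)) (≡.trans (monomial-⋆ K (geomInv K) n) (shiftBy-below K _ n n<K)) ⟨
      (1# + monomial K * geomInv K) n      ∎
    ... | inj₂ K≤n with ℕP.m≤n⇒∃[o]m+o≡n K≤n
    ...   | m , ≡.refl = begin
      geomInv K (K ℕ.+ m)                        ≡⟨ geomInv-periodic K m ⟩
      geomInv K m                                ≡⟨ shiftBy-+ K (geomInv K) m ⟨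
      shiftBy K (geomInv K) (K ℕ.+ m)            ≡⟨ monomial-⋆ K (geomInv K) (K ℕ.+ m) ⟨
      (monomial K * geomInv K) (K ℕ.+ m)         ≡⟨ ℤP.+-identityˡ _ ⟨
      + 0 ℤ.+ (monomial K * geomInv K) (K ℕ.+ m) ≡⟨ cong (ℤ._+ (monomial K * geomInv K) (K ℕ.+ m)) (oneS-beyond 0<K) ⟨
      (1# + monomial K * geomInv K) (K ℕ.+ m)    ∎
      where
      oneS-beyond : 0 < K → oneS (K ℕ.+ m) ≡ + 0
      oneS-beyond z<s = ≡.refl

  geomInv≈1 : ∀ {K} → 0 < K → geomInv K ≈ 1# [mod monomial K ]
  geomInv≈1 {K} 0<K = mod-by (geomInv K) (geomInv-unfold 0<K)

  oneMinus≈1 : ∀ {K} → 0 < K → oneMinus K ≈ 1# [mod monomial K ]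
  oneMinus≈1 {K} 0<K = ≈[mod]-trans (≈⇒≈[mod] (monomial K) (oneMinus≈1-monomial 0<K)) (1-y≈1 (monomial K))

  powS≈^ : ∀ f a → powS f a ≈ f ^ a
  powS≈^ f zero    = refl
  powS≈^ f (suc a) = *-congˡ {f} (powS≈^ f a)

  geomInv*oneMinus : ∀ {K} → 0 < K → geomInv K * oneMinus K ≈ 1#
  geomInv*oneMinus {K} 0<K = trans (*-congˡ {geomInv K} (oneMinus≈1-monomial 0<K)) (geometric-inverse (geomInv-unfold 0<K))

  ≈[mod-monomial]⇒≡ : ∀ {f g K} → f ≈ g [mod monomial K ] → ∀ n → n < K → f n ≡ g n
  ≈[mod-monomial]⇒≡ {f} {g} {K} (mod-by h f≈g+x^Kh) n n<K = ≡.trans (coeff f≈g+x^Kh n)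
    (≡.trans (cong (ℤ._+_ (g n)) (≡.trans (monomial-⋆ K h n) (shiftBy-below K h n n<K))) (ℤP.+-identityʳ (g n)))

  ι-⋆ : ∀ k f → ι k * f ≗ scale (+ k) f
  ι-⋆ zero    f = zeroS-⋆ f
  ι-⋆ (suc k) f n = begin
    ((1# + ι k) * f) n                 ≡⟨ coeff (distribʳ f 1# (ι k)) n ⟩
    (1# * f) n ℤ.+ (ι k * f) n         ≡⟨ cong₂ ℤ._+_ (oneS-⋆ f n) (ι-⋆ k f n) ⟩
    f n ℤ.+ + k ℤ.* f n                ≡⟨ cong (ℤ._+ + k ℤ.* f n) (ℤP.*-identityˡ (f n)) ⟨
    + 1 ℤ.* f n ℤ.+ + k ℤ.* f n        ≡⟨ ℤP.*-distribʳ-+ (f n) (+ 1) (+ k) ⟨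
    + suc k ℤ.* f n                    ∎
    where open ≡.≡-Reasoning

  module _ {p-3 : ℕ} (p-prime : Prime (3 ℕ.+ p-3)) where

    private
      p = 3 ℕ.+ p-3
      P = ι p

    open import Algebra.Properties.Semiring.Exp (CommutativeRing.semiring seriesRing) using (^-congˡ)
    open import Algebra.Properties.CommutativeSemiring.Exp (CommutativeRing.commutativeSemiring seriesRing) using (^-distrib-*)

    p^n>0 : ∀ n → 0 < p ℕ.^ n
    p^n>0 = ℕP.m^n>0 p

    oneMinus-^p : ∀ {K} → 0 < K → oneMinus K ^ p ≈ oneMinus (p ℕ.* K) [mod P ]
    oneMinus-^p {suc k} 0<K = begin
      oneMinus (suc k) ^ p               ≈⟨ ≈⇒≈[mod] P (^-congˡ p (oneMinus≈1-monomial 0<K)) ⟩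
      (1# - monomial (suc k)) ^ p        ≈⟨ 1-y-^p p-prime (monomial (suc k)) ⟩
      1# - monomial (suc k) ^ p          ≈⟨ ≈⇒≈[mod] P (+-congˡ {1#} (-‿cong (monomial-^ (suc k) p))) ⟩
      1# - monomial (p ℕ.* suc k)        ≈⟨ ≈⇒≈[mod] P (oneMinus≈1-monomial z<s) ⟨
      oneMinus (p ℕ.* suc k)             ∎
      where open ≈[mod]-Reasoning P

    -- Φ geomInv N and Φ oneMinus N are the truncations at i < N of T and G = 1/T.
    Π Φ : (ℕ → Series) → ℕ → Series
    Π φ N = ∏< N (λ i → φ (p ℕ.^ i) ^ (p ∸ 1))
    Φ φ N = φ 1 * Π φ N

    Φ-^ : ∀ (φ : ℕ → Series) a N → φ 1 ^ a * ∏< N (λ i → φ (p ℕ.^ i) ^ ((p ∸ 1) ℕ.* a)) ≈ Φ φ N ^ a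
    Φ-^ φ a N = trans (*-congˡ {φ 1 ^ a} (∏<-^ (λ i → φ (p ℕ.^ i)) (p ∸ 1) a N)) (sym (^-distrib-* (φ 1) (Π φ N) a))

    prodFactors≈∏< : ∀ {e} (φ : ℕ → Series) b → (∀ k → invPow k e ≡ powS (φ k) b) → ∀ N → prodFactors p e N ≈ ∏< N (λ i → φ (p ℕ.^ i) ^ b)
    prodFactors≈∏< φ b invPow≡ zero    = refl
    prodFactors≈∏< {e} φ b invPow≡ (suc N) = *-cong {prodFactors p e N} {∏< N (λ i → φ (p ℕ.^ i) ^ b)} {invPow (p ℕ.^ N) e}
      (prodFactors≈∏< φ b invPow≡ N) (trans (reflexive (invPow≡ (p ℕ.^ N))) (powS≈^ (φ (p ℕ.^ N)) b))

    d≡Φ-geomInv : ∀ a n → d p (+ a) n ≡ (Φ geomInv (suc n) ^ a) n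
    d≡Φ-geomInv a n = (begin
      powS (geomInv 1) a * prodFactors p (+ (p ∸ 1) ℤ.* + a) (suc n)
        ≈⟨ *-cong (powS≈^ (geomInv 1) a)
                  (prodFactors≈∏< {+ (p ∸ 1) ℤ.* + a} geomInv ((p ∸ 1) ℕ.* a) (λ k → cong (invPow k) (≡.sym (ℤP.pos-* (p ∸ 1) a))) (suc n)) ⟩
      geomInv 1 ^ a * ∏< (suc n) (λ i → geomInv (p ℕ.^ i) ^ ((p ∸ 1) ℕ.* a))
        ≈⟨ Φ-^ geomInv a (suc n) ⟩
      Φ geomInv (suc n) ^ a ∎) .coeff n
      where open import Relation.Binary.Reasoning.Setoid setoid

    d≡Φ-oneMinus : ∀ a n → d p -[1+ a ] n ≡ (Φ oneMinus (suc n) ^ suc a) n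
    d≡Φ-oneMinus a n = (begin
      powS (oneMinus 1) (suc a) * prodFactors p (+ (p ∸ 1) ℤ.* -[1+ a ]) (suc n)
        ≈⟨ *-cong (powS≈^ (oneMinus 1) (suc a)) (prodFactors≈∏< {+ (p ∸ 1) ℤ.* -[1+ a ]} oneMinus ((p ∸ 1) ℕ.* suc a) (λ _ → ≡.refl) (suc n)) ⟩
      oneMinus 1 ^ suc a * ∏< (suc n) (λ i → oneMinus (p ℕ.^ i) ^ ((p ∸ 1) ℕ.* suc a))
        ≈⟨ Φ-^ oneMinus (suc a) (suc n) ⟩
      Φ oneMinus (suc n) ^ suc a ∎) .coeff n
      where open import Relation.Binary.Reasoning.Setoid setoid

    Φ-inverse : ∀ N → Φ geomInv N * Φ oneMinus N ≈ 1#
    Φ-inverse N = inverse-* {geomInv 1} {oneMinus 1} {Π geomInv N} {Π oneMinus N} (geomInv*oneMinus z<s) (∏<-inverse N factors-inverse)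
      where
      factors-inverse : ∀ i → geomInv (p ℕ.^ i) ^ (p ∸ 1) * oneMinus (p ℕ.^ i) ^ (p ∸ 1) ≈ 1#
      factors-inverse i = trans (sym (^-distrib-* (geomInv (p ℕ.^ i)) (oneMinus (p ℕ.^ i)) (p ∸ 1)))
                                (trans (^-congˡ (p ∸ 1) (geomInv*oneMinus (p^n>0 i))) (1#-^ (p ∸ 1)))

    Φ-oneMinus : ∀ N → Φ oneMinus N ≈ oneMinus (p ℕ.^ N) [mod P ]
    Φ-oneMinus zero    = ≈⇒≈[mod] P (*-identityʳ (oneMinus 1))
    Φ-oneMinus (suc N) = begin
      oneMinus 1 * (Π oneMinus N * f N)                 ≈⟨ ≈⇒≈[mod] P (sym (*-assoc (oneMinus 1) (Π oneMinus N) (f N))) ⟩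
      Φ oneMinus N * f N                                ≈⟨ ≈[mod]-* (Φ-oneMinus N) (≈⇒≈[mod] P (refl {f N})) ⟩
      oneMinus (p ℕ.^ N) * oneMinus (p ℕ.^ N) ^ (p ∸ 1) ≈⟨ oneMinus-^p (p^n>0 N) ⟩
      oneMinus (p ℕ.^ suc N)                            ∎
      where
      open ≈[mod]-Reasoning P
      f : ℕ → Series
      f i = oneMinus (p ℕ.^ i) ^ (p ∸ 1)

    Φ-geomInv : ∀ N → Φ geomInv N ≈ geomInv (p ℕ.^ N) [mod P ]
    Φ-geomInv N = inverses-≈[mod] (Φ-inverse N) (geomInv*oneMinus (p^n>0 N)) (Φ-oneMinus N)

    n<p^[1+n] : ∀ n → n < p ℕ.^ suc n
    n<p^[1+n] n = n≤p^n (s≤s (s≤s z≤n)) (suc n)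

    below-p^[1+n] : ∀ {F u} n (F≡u : F ≈ u [mod P ]) → u ≈ 1# [mod monomial (p ℕ.^ suc n) ] →
                    ∀ a → (F ^ a) n ≡ ((1# + P * _≈_[mod_].quotient F≡u) ^ a) n
    below-p^[1+n] n F≡u u≡1 a = ≈[mod-monomial]⇒≡ (≈[mod]-^ (≈[mod]-split F≡u u≡1) a) n (n<p^[1+n] n)

    d-as-power⁺ : ∀ n → ∃ λ V → ∀ a → d p (+ a) n ≡ ((1# + P * V) ^ a) n
    d-as-power⁺ n = _ , λ a → ≡.trans (d≡Φ-geomInv a n) (below-p^[1+n] n (Φ-geomInv (suc n)) (geomInv≈1 (p^n>0 (suc n))) a)

    d-as-power⁻ : ∀ n → ∃ λ V → ∀ a → d p -[1+ a ] n ≡ ((1# + P * V) ^ suc a) n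
    d-as-power⁻ n = _ , λ a → ≡.trans (d≡Φ-oneMinus a n) (below-p^[1+n] n (Φ-oneMinus (suc n)) (oneMinus≈1 (p^n>0 (suc n))) (suc a))

    power-residue : ∀ U n → ResidueForm p (U (suc n)) (λ m → ((1# + P * U) ^ m) (suc n))
    power-residue U n m 0<m with p-free-part (s≤s (s≤s z≤n)) m 0<m
    ... | c , v , m≡cp^v , p∤c = c , p ℕ.^ suc v , E (suc n) , p∤c , p*m≡ , coefficient
      where
      open _≈_[mod_] (1+py-^[cp^v] (prime∣pCk p-prime (s≤s z≤n) (s≤s (s≤s (s≤s z≤n)))) U c v)
        renaming (quotient to E; ≈+multiple to expansion)
      open ≡.≡-Reasoning
      p*m≡ : p ℕ.* m ≡ c ℕ.* p ℕ.^ suc v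
      p*m≡ = ≡.trans (cong (p ℕ.*_) m≡cp^v) (swap p c (p ℕ.^ v))
        where
        swap : ∀ a b c → a ℕ.* (b ℕ.* c) ≡ b ℕ.* (a ℕ.* c)
        swap = ℕ-Solver.solve-∀
      coefficient : ((1# + P * U) ^ m) (suc n) ≡ + (c ℕ.* p ℕ.^ suc v) ℤ.* U (suc n) ℤ.+ + (p ℕ.* p ℕ.^ suc v) ℤ.* E (suc n)
      coefficient = begin
        ((1# + P * U) ^ m) (suc n)
          ≡⟨ cong (λ k → ((1# + P * U) ^ k) (suc n)) m≡cp^v ⟩
        ((1# + P * U) ^ (c ℕ.* p ℕ.^ v)) (suc n)
          ≡⟨ coeff expansion (suc n) ⟩
        + 0 ℤ.+ (ι (c ℕ.* p ℕ.^ suc v) * U) (suc n) ℤ.+ (ι (p ℕ.^ suc (suc v)) * E) (suc n)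
          ≡⟨ cong₂ (λ a b → + 0 ℤ.+ a ℤ.+ b) (ι-⋆ (c ℕ.* p ℕ.^ suc v) U (suc n)) (ι-⋆ (p ℕ.^ suc (suc v)) E (suc n)) ⟩
        + 0 ℤ.+ + (c ℕ.* p ℕ.^ suc v) ℤ.* U (suc n) ℤ.+ + (p ℕ.* p ℕ.^ suc v) ℤ.* E (suc n)
          ≡⟨ cong (ℤ._+ + (p ℕ.* p ℕ.^ suc v) ℤ.* E (suc n)) (ℤP.+-identityˡ (+ (c ℕ.* p ℕ.^ suc v) ℤ.* U (suc n))) ⟩
        + (c ℕ.* p ℕ.^ suc v) ℤ.* U (suc n) ℤ.+ + (p ℕ.* p ℕ.^ suc v) ℤ.* E (suc n) ∎

    residue⁺ : ∀ n → ∃ λ W → ResidueForm p W (λ m → d p (+ m) (suc n))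
    residue⁺ n = V (suc n) , ResidueForm-cong (λ m _ → d≡ m) (power-residue V n)
      where open Σ (d-as-power⁺ (suc n)) renaming (proj₁ to V; proj₂ to d≡)

    residue⁻ : ∀ n → ∃ λ W → ResidueForm p W (λ m → ℤ.- d p -[1+ m ∸ 1 ] (suc n))
    residue⁻ n = ℤ.- V (suc n) , ResidueForm-cong (λ { (suc a) _ → cong ℤ.-_ (d≡ a) }) (ResidueForm-negate (power-residue V n))
      where open Σ (d-as-power⁻ (suc n)) renaming (proj₁ to V; proj₂ to d≡)

data SignView : ℤ → ℤ → Set where
  both-positive : ∀ a₁ a₂ → SignView (+ suc a₁) (+ suc a₂)
  both-negative : ∀ a₁ a₂ → SignView -[1+ a₁ ] -[1+ a₂ ]

signView : ∀ {m₁ m₂} → SameSign m₁ m₂ → SignView m₁ m₂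
signView (inj₁ (ℤ.+<+ z<s , ℤ.+<+ z<s)) = both-positive _ _
signView (inj₂ (ℤ.-<+ , ℤ.-<+))          = both-negative _ _

open import Data.Integer using (_*_)

corollary3p9 : (p : ℕ) → Prime p → 3 ≤ p → (m₁ m₂ : ℤ) → SameSign m₁ m₂ → (n : ℕ) → 1 ≤ n → divQ (d p m₁ n) (+ p * m₁) ≡ divQ (d p m₂ n) (+ p * m₂) [modℚ p ]
corollary3p9 _ p-prime (s≤s (s≤s (s≤s z≤n))) m₁ m₂ same-sign (suc n) z<s with signView same-sign
... | both-positive a₁ a₂ = ResidueForm-congruent p-prime (proj₂ (residue⁺ p-prime n)) {suc a₁} {suc a₂} z<s z<s ≡.refl ≡.refl
... | both-negative a₁ a₂ = ResidueForm-congruent p-prime (proj₂ (residue⁻ p-prime n)) {suc a₁} {suc a₂} z<s z<s ≡.refl ≡.refl
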